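{- Let $n,m\ge 0$ be integers and let $\alpha,\beta$ be partitions that are complementary relative to the rectangle $\square(n,m)$. If $\mu$ is a partition with empty $2$-core whose $2$-quotient is $(\mu[0],\mu[1])=(\alpha,\beta)$, then $\mu$ is $(n,m)$-balanced.
   Context: $\square(n,m)$ is the partition $(m^n)$. Partitions $\alpha,\beta$ are complementary relative to $\square(n,m)$ if $\alpha\subseteq\square(n,m)$ and the skew shape $\square(n,m)\setminus\alpha$ is the $180^\circ$ rotation of the diagram of $\beta$ (equivalently $\beta_i=m-\alpha_{n+1-i}$ for $1\le i\le n$). 2-quotient and 2-core: for a partition $\lambda=(\lambda_1,\dots,\lambda_N)$ padded with zeros so that $N$ is even, put $\delta_N=(N-1,\dots,1,0)$, $\xi=\lambda+\delta_N$; for $k=0,1$ let $\xi^{(k)}$ be the elements of $\{(\xi_i-k)/2:\xi_i\equiv k\pmod 2\}$ in decreasing order, of length $N_k$; then $\lambda[k]=\xi^{(k)}-\delta_{N_k}$. The 2-core is $\tilde\xi-\delta_N$, where $\tilde\xi$ is the decreasing arrangement of $\bigcup_{k=0,1}\{2s+k:0\le s\le N_k-1\}$. A partition $\lambda=(\lambda_1,\dots,\lambda_{2n})$ (weakly decreasing, nonnegative entries) of $2nm$ is $(n,m)$-balanced if $\lambda_i+\lambda_{2n+1-i}=2m$ for $1\le i\le n$. -}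

module Defs where

open import Data.Nat using (ℕ; zero; suc; _+_; _*_; _∸_; _≤_; _<_; _≥_; _≟_)
open import Data.Nat.DivMod using (_/_; _%_)
open import Data.Nat.Properties using (≤-decTotalOrder)
open import Data.List using (List; []; _∷_; length; zipWith; map; filter; reverse; replicate; _++_; upTo; downFrom)
open import Data.Nat.ListAction using (sum)
open import Data.List.Relation.Unary.Linked using (Linked)
open import Relation.Binary.PropositionalEquality using (_≡_)
import Data.List.Sort.InsertionSort

-- Partitions are finite lists of naturals, weakly decreasing.
-- Trailing zeros are allowed; partitions are compared entrywise via `part`.
IsPartition : List ℕ → Set
IsPartition λs = Linked _≥_ λs

-- i-th part (0-indexed), 0 beyond the length (padding with zeros).
part : List ℕ → ℕ → ℕ
part []       _       = 0
part (x ∷ xs) zero    = x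
part (x ∷ xs) (suc i) = part xs i

_≈ₚ_ : List ℕ → List ℕ → Set
λs ≈ₚ μs = ∀ i → part λs i ≡ part μs i

pad : List ℕ → ℕ → List ℕ
pad λs N = λs ++ replicate (N ∸ length λs) 0

evenLen : List ℕ → ℕ
evenLen λs = length λs + (length λs % 2)

δ : ℕ → List ℕ
δ N = downFrom N

ξ : List ℕ → List ℕ
ξ λs = zipWith _+_ (pad λs (evenLen λs)) (δ (evenLen λs))

-- ξ^(k): elements (ξ_i - k)/2 with ξ_i ≡ k mod 2, in decreasing order
-- (ξ is strictly decreasing, so filtering preserves decreasing order).
ξk : List ℕ → ℕ → List ℕ
ξk λs k = map (λ x → (x ∸ k) / 2) (filter (λ x → x % 2 ≟ k) (ξ λs))

quot2 : List ℕ → ℕ → List ℕ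
quot2 λs k = zipWith _∸_ (ξk λs k) (δ (length (ξk λs k)))

open Data.List.Sort.InsertionSort ≤-decTotalOrder using (sort)

ξ̃ : List ℕ → List ℕ
ξ̃ λs = reverse (sort ( map (λ s → 2 * s) (upTo (length (ξk λs 0)))
                     ++ map (λ s → 2 * s + 1) (upTo (length (ξk λs 1)))))

core2 : List ℕ → List ℕ
core2 λs = zipWith _∸_ (ξ̃ λs) (δ (evenLen λs))

EmptyCore2 : List ℕ → Set
EmptyCore2 λs = core2 λs ≈ₚ []

Complementary : ℕ → ℕ → List ℕ → List ℕ → Set
Complementary n m α β =
  (∀ i → n ≤ i → part α i ≡ 0) ×' ((∀ i → part α i ≤ m) ×'
  ((∀ i → n ≤ i → part β i ≡ 0) ×'
   (∀ i → i < n → part β i ≡ m ∸ part α (n ∸ 1 ∸ i))))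
  where
  open import Data.Product using () renaming (_×_ to _×'_)

Balanced : ℕ → ℕ → List ℕ → Set
Balanced n m λs =
  (∀ i → 2 * n ≤ i → part λs i ≡ 0) ×'
  ((sum λs ≡ 2 * n * m) ×'
   (∀ i → i < n → part λs i + part λs (2 * n ∸ 1 ∸ i) ≡ 2 * m))
  where
  open import Data.Product using () renaming (_×_ to _×'_)

{-# OPTIONS --safe #-}
-- Work with beta sets: λ ↦ ξ = λ + δ_N, a strictly decreasing list that determines λ.
-- With N = 2L beta numbers, the even and odd elements of the beta set of μ, halved, are
-- the beta sets of its 2-quotient (α, β); an empty 2-core means both have L elements.
-- Adding 2n beta numbers to μ (and n to α and β) and using that α and β have at most n
-- rows, the beta set of μ becomes [0, 2L) together with 2L + T, where T merges the
-- n-element beta sets of α and β. Since β is the complement of α in the n × m box, the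
-- beta set of β is the reflection x ↦ m + n − 1 − x of that of α, so T is closed under
-- x ↦ 2(m + n) − 1 − x. A strictly decreasing list is determined by its elements, so μ
-- has at most 2n rows with beta set T, and the reflection symmetry of that list is the
-- identity μ_i + μ_{2n−1−i} = 2m.
module Submission where

open import Defs
open import Algebra.Bundles using (CommutativeMonoid)
open import Algebra.Properties.CommutativeSemigroup using (interchange)
open import Data.Empty using (⊥-elim)
open import Data.List using (List; []; _∷_; length; map; filter; reverse; _ʳ++_; _++_; zipWith; downFrom; upTo; replicate)
open import Data.List.Membership.Propositional using (_∈_)
open import Data.List.Membership.Propositional.Properties
  using (∈-map⁺; ∈-map⁻; ∈-++⁺ˡ; ∈-++⁺ʳ; ∈-++⁻; ∈-filter⁺; ∈-filter⁻; ∈-downFrom⁺; ∈-downFrom⁻; ∈-upTo⁺)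
open import Data.List.Properties
  using (length-map; length-++; length-replicate; length-downFrom; length-reverse; length-zipWith; length-upTo;
         map-++; map-∘; ∷-injectiveˡ; ∷-injectiveʳ; filter-complete)
  renaming (map-cong to map-≗)
open import Data.List.Relation.Binary.BagAndSetEquality
  using (_∼[_]_; set; [_]-Equality; commutativeMonoid; map-cong; ++-cong)
open import Data.List.Relation.Binary.Permutation.Propositional using (↭-sym)
open import Data.List.Relation.Binary.Permutation.Propositional.Properties
  using (↭-reverse; map⁺; ↭-length; ∈-resp-↭)
open import Data.List.Relation.Unary.All as All using (All; []; _∷_)
open import Data.List.Relation.Unary.All.Properties using (all-filter)
open import Data.List.Relation.Unary.Any using (here; there)
open import Data.List.Relation.Unary.Any.Properties using (reverse⁺; reverse⁻)
open import Data.List.Relation.Unary.Linked as Linked using (Linked; []; [-]; _∷_)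
open import Data.List.Relation.Unary.Linked.Properties using (Linked⇒All) renaming (filter⁺ to Linked-filter⁺)
open import Data.Nat using (ℕ; zero; suc; _+_; _*_; _∸_; _≤_; _<_; _≥_; _>_; z≤n; s≤s; _<?_; _≟_)
open import Data.Nat.DivMod using (_/_; _%_; m≡m%n+[m/n]*n; m*n/n≡m; m%n<n)
open import Data.Nat.ListAction using (sum)
open import Data.Nat.ListAction.Properties using (sum-↭)
open import Data.Nat.Properties
open import Data.Nat.Tactic.RingSolver using (solve-∀)
open import Data.List.Sort.InsertionSort ≤-decTotalOrder using (sort)
open import Data.List.Sort.InsertionSort.Properties ≤-decTotalOrder using (sort-↭; sort-↗)
open import Data.Product using (∃; ∃₂; _×_; _,_; proj₁; proj₂)
open import Data.Sum using (_⊎_; inj₁; inj₂)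
open import Function using (_∘_; flip; Equivalence; mk⇔)
open import Function.Related.Propositional using (SymmetricKind)
open import Relation.Binary.Bundles using (Setoid)
open import Relation.Binary.PropositionalEquality
import Relation.Binary.Reasoning.Setoid as SetoidReasoning
open import Relation.Nullary using (yes; no; contradiction)

open Equivalence using (to; from)

Antitone : (ℕ → ℕ) → Set
Antitone f = ∀ i → f (suc i) ≤ f i

VanishesFrom : ℕ → (ℕ → ℕ) → Set
VanishesFrom N f = ∀ i → N ≤ i → f i ≡ 0

_∼_ : List ℕ → List ℕ → Set
xs ∼ ys = xs ∼[ set ] ys

module ∼ = Setoid ([ SymmetricKind.equivalence ]-Equality ℕ)
module ∼-Reasoning = SetoidReasoning ([ SymmetricKind.equivalence ]-Equality ℕ)

part-beyond : ∀ xs {i} → length xs ≤ i → part xs i ≡ 0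
part-beyond []       _           = refl
part-beyond (x ∷ xs) (s≤s len≤i) = part-beyond xs len≤i

part-antitone : ∀ {xs} → IsPartition xs → Antitone (part xs)
part-antitone []        _       = z≤n
part-antitone [-]       _       = z≤n
part-antitone (x≥y ∷ _) zero    = x≥y
part-antitone (_ ∷ xs↘) (suc i) = part-antitone xs↘ i

part-ext : ∀ xs ys → length xs ≡ length ys → (∀ i → i < length xs → part xs i ≡ part ys i) → xs ≡ ys
part-ext []       []       _   _  = refl
part-ext (x ∷ xs) (y ∷ ys) len eq =
  cong₂ _∷_ (eq 0 (s≤s z≤n)) (part-ext xs ys (suc-injective len) (λ i i< → eq (suc i) (s≤s i<)))

part-map : ∀ (f : ℕ → ℕ) xs {i} → i < length xs → part (map f xs) i ≡ f (part xs i)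
part-map f (x ∷ xs) {zero}  _        = refl
part-map f (x ∷ xs) {suc i} (s≤s i<) = part-map f xs i<

∈-part : ∀ xs {j} → j < length xs → part xs j ∈ xs
∈-part (x ∷ xs) {zero}  _        = here refl
∈-part (x ∷ xs) {suc j} (s≤s j<) = there (∈-part xs j<)

part-ʳ++ʳ : ∀ xs ys k → part (xs ʳ++ ys) (k + length xs) ≡ part ys k
part-ʳ++ʳ []       ys k = cong (part ys) (+-identityʳ k)
part-ʳ++ʳ (x ∷ xs) ys k =
  trans (cong (part (xs ʳ++ x ∷ ys)) (+-suc k (length xs))) (part-ʳ++ʳ xs (x ∷ ys) (suc k))

part-ʳ++ˡ : ∀ xs ys {i j} → suc (j + i) ≡ length xs → part (xs ʳ++ ys) i ≡ part xs j
part-ʳ++ˡ (x ∷ xs) ys {j = zero}  refl = part-ʳ++ʳ xs (x ∷ ys) 0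
part-ʳ++ˡ (x ∷ xs) ys {j = suc j} eq   = part-ʳ++ˡ xs (x ∷ ys) (suc-injective eq)

-- Indices i, j with suc (i + j) ≡ length xs are mirror positions; this avoids truncated subtraction.
part-reverse : ∀ xs {i j} → suc (i + j) ≡ length xs → part (reverse xs) i ≡ part xs j
part-reverse xs {i} {j} i+j≡ = part-ʳ++ˡ xs [] (trans (cong suc (+-comm j i)) i+j≡)

Linked-ʳ++ : ∀ {R : ℕ → ℕ → Set} {x xs acc} →
             Linked R (x ∷ xs) → Linked (flip R) (x ∷ acc) → Linked (flip R) (xs ʳ++ x ∷ acc)
Linked-ʳ++ [-]         acc↗ = acc↗
Linked-ʳ++ (Rxy ∷ xs↘) acc↗ = Linked-ʳ++ xs↘ (Rxy ∷ acc↗)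

Linked-reverse : ∀ {R : ℕ → ℕ → Set} {xs} → Linked R xs → Linked (flip R) (reverse xs)
Linked-reverse {xs = []}    []  = []
Linked-reverse {xs = _ ∷ _} xs↘ = Linked-ʳ++ xs↘ [-]

map⁺-on : ∀ {R S : ℕ → ℕ → Set} {P : ℕ → Set} {h : ℕ → ℕ} {xs} →
          (∀ {x y} → P x → P y → R x y → S (h x) (h y)) → All P xs → Linked R xs → Linked S (map h xs)
map⁺-on mono _              []         = []
map⁺-on mono _              [-]        = [-]
map⁺-on mono (Px ∷ Py ∷ Ps) (Rxy ∷ R↘) = mono Px Py Rxy ∷ map⁺-on mono (Py ∷ Ps) R↘

strict-head : ∀ {x xs} → Linked _>_ (x ∷ xs) → All (_< x) xs
strict-head [-]         = []
strict-head (x>y ∷ xs↘) = Linked⇒All (λ p q → <-trans q p) x>y xs↘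

strict-≤-head : ∀ {x xs z} → Linked _>_ (x ∷ xs) → z ∈ x ∷ xs → z ≤ x
strict-≤-head _   (here refl) = ≤-refl
strict-≤-head xs↘ (there z∈)  = <⇒≤ (All.lookup (strict-head xs↘) z∈)

strict-length : ∀ {x xs} → Linked _>_ (x ∷ xs) → length xs ≤ x
strict-length [-]         = z≤n
strict-length (x>y ∷ xs↘) = ≤-<-trans (strict-length xs↘) x>y

strict-≡ : ∀ {xs ys} → Linked _>_ xs → Linked _>_ ys → xs ∼ ys → xs ≡ ys
strict-≡ {[]}     {[]}     _ _ _ = refl
strict-≡ {[]}     {y ∷ ys} _ _ xs∼ys with () ← from xs∼ys (here refl)
strict-≡ {x ∷ xs} {[]}     _ _ xs∼ys with () ← to xs∼ys (here refl)
strict-≡ {x ∷ xs} {y ∷ ys} xs↘ ys↘ xs∼ys =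
  cong₂ _∷_ x≡y (strict-≡ (Linked.tail xs↘) (Linked.tail ys↘)
                          (mk⇔ (λ z∈ → drop xs↘ x≡y z∈ (to xs∼ys (there z∈)))
                               (λ z∈ → drop ys↘ (sym x≡y) z∈ (from xs∼ys (there z∈)))))
  where
  x≡y : x ≡ y
  x≡y = ≤-antisym (strict-≤-head ys↘ (to xs∼ys (here refl))) (strict-≤-head xs↘ (from xs∼ys (here refl)))
  drop : ∀ {u us v vs z} → Linked _>_ (u ∷ us) → u ≡ v → z ∈ us → z ∈ v ∷ vs → z ∈ vs
  drop us↘ refl z∈us (here refl)  = ⊥-elim (<-irrefl refl (All.lookup (strict-head us↘) z∈us))
  drop _    _    _    (there z∈vs) = z∈vs

-- Beta numbers

-- The paper's ξ = λ + δ_N for λ = (f 0, …, f (N ∸ 1)).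
beta : (ℕ → ℕ) → ℕ → List ℕ
beta f zero    = []
beta f (suc N) = f 0 + N ∷ beta (f ∘ suc) N

length-beta : ∀ f N → length (beta f N) ≡ N
length-beta f zero    = refl
length-beta f (suc N) = cong suc (length-beta (f ∘ suc) N)

beta-cong : ∀ {f g} N → (∀ i → f i ≡ g i) → beta f N ≡ beta g N
beta-cong zero    _   = refl
beta-cong (suc N) f≗g = cong₂ _∷_ (cong (_+ N) (f≗g 0)) (beta-cong N (f≗g ∘ suc))

beta-injective : ∀ {f g} N → beta f N ≡ beta g N → ∀ {i} → i < N → f i ≡ g i
beta-injective (suc N) eq {zero}  _        = +-cancelʳ-≡ N _ _ (∷-injectiveˡ eq)
beta-injective (suc N) eq {suc i} (s≤s i<) = beta-injective N (∷-injectiveʳ eq) i<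

beta-zero : ∀ N → beta (λ _ → 0) N ≡ downFrom N
beta-zero zero    = refl
beta-zero (suc N) = cong (N ∷_) (beta-zero N)

part-beta : ∀ f N {i j} → suc (i + j) ≡ N → part (beta f N) i ≡ f i + j
part-beta f (suc N) {zero}  refl = refl
part-beta f (suc N) {suc i} eq   = part-beta (f ∘ suc) N (suc-injective eq)

∈-beta⁻ : ∀ f N {x} → x ∈ beta f N → ∃₂ λ i j → suc (i + j) ≡ N × x ≡ f i + j
∈-beta⁻ f (suc N) (here x≡)  = 0 , N , refl , x≡
∈-beta⁻ f (suc N) (there x∈) with i , j , i+j≡ , x≡ ← ∈-beta⁻ (f ∘ suc) N x∈ =
  suc i , j , cong suc i+j≡ , x≡

beta-strict : ∀ {f} N → Antitone f → Linked _>_ (beta f N)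
beta-strict zero          _  = []
beta-strict (suc zero)    _  = [-]
beta-strict (suc (suc N)) f↘ = +-mono-≤-< (f↘ 0) (n<1+n N) ∷ beta-strict (suc N) (f↘ ∘ suc)

antitone-shift : ∀ {f} K → Antitone f → Antitone (λ i → f (K + i))
antitone-shift {f} K f↘ i = subst (λ j → f j ≤ f (K + i)) (sym (+-suc K i)) (f↘ (K + i))

beta-++ : ∀ f K M → beta f (K + M) ≡ map (M +_) (beta f K) ++ beta (λ i → f (K + i)) M
beta-++ f zero    M = refl
beta-++ f (suc K) M = cong₂ _∷_ (shift (f 0) K M) (beta-++ (f ∘ suc) K M)
  where
  shift : ∀ a K M → a + (K + M) ≡ M + (a + K)
  shift = solve-∀

shiftBeta : ℕ → List ℕ → List ℕ
shiftBeta t xs = map (t +_) xs ++ downFrom t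

beta-+ : ∀ {f} N t → VanishesFrom N f → beta f (N + t) ≡ shiftBeta t (beta f N)
beta-+ {f} N t f-vanishes = begin
  beta f (N + t)                                     ≡⟨ beta-++ f N t ⟩
  map (t +_) (beta f N) ++ beta (λ i → f (N + i)) t  ≡⟨ cong (map (t +_) (beta f N) ++_) tail≡ ⟩
  shiftBeta t (beta f N)                             ∎
  where
  open ≡-Reasoning
  tail≡ : beta (λ i → f (N + i)) t ≡ downFrom t
  tail≡ = trans (beta-cong t (λ i → f-vanishes (N + i) (m≤m+n N i))) (beta-zero t)

shiftBeta-swap : ∀ {f} L n → VanishesFrom L f → VanishesFrom n f →
                 shiftBeta n (beta f L) ≡ shiftBeta L (beta f n)
shiftBeta-swap {f} L n f-L f-n =
  trans (sym (beta-+ L n f-L)) (trans (cong (beta f) (+-comm L n)) (beta-+ n L f-n))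

shiftBeta-cong : ∀ t {xs ys} → xs ∼ ys → shiftBeta t xs ∼ shiftBeta t ys
shiftBeta-cong t xs∼ys = ++-cong (map-cong (λ _ → refl) xs∼ys) ∼.refl

∈-shiftBeta⁺ : ∀ t {x xs} → x ∈ xs → t + x ∈ shiftBeta t xs
∈-shiftBeta⁺ t x∈ = ∈-++⁺ˡ (∈-map⁺ (t +_) x∈)

∈-shiftBeta⁻ : ∀ t {x} xs → t + x ∈ shiftBeta t xs → x ∈ xs
∈-shiftBeta⁻ t {x} xs t+x∈ with ∈-++⁻ (map (t +_) xs) t+x∈
... | inj₁ ∈shifted with y , y∈ , t+x≡t+y ← ∈-map⁻ (t +_) ∈shifted =
  subst (_∈ xs) (sym (+-cancelˡ-≡ t x y t+x≡t+y)) y∈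
... | inj₂ ∈downFrom = ⊥-elim (m+n≮m t x (∈-downFrom⁻ ∈downFrom))

shiftBeta-cancel : ∀ t {xs ys} → shiftBeta t xs ∼ shiftBeta t ys → xs ∼ ys
shiftBeta-cancel t {xs} {ys} eq =
  mk⇔ (λ x∈ → ∈-shiftBeta⁻ t ys (to eq (∈-shiftBeta⁺ t x∈)))
      (λ y∈ → ∈-shiftBeta⁻ t xs (from eq (∈-shiftBeta⁺ t y∈)))

strict-downFrom : ∀ {t D} → Linked _>_ D → length D ≡ t → (∀ {r} → r < t → r ∈ D) → D ≡ downFrom t
strict-downFrom {t} {D} D↘ length≡t small∈D = trans (sym (filter-complete (_<? t) length-filter)) filter≡
  where
  filter≡ : filter (_<? t) D ≡ downFrom t
  filter≡ = strict-≡ (Linked-filter⁺ (_<? t) (λ p q → <-trans q p) D↘)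
                     (subst (Linked _>_) (beta-zero t) (beta-strict t (λ _ → z≤n)))
                     (mk⇔ (∈-downFrom⁺ ∘ proj₂ ∘ ∈-filter⁻ (_<? t) {xs = D})
                          (λ r∈ → ∈-filter⁺ (_<? t) (small∈D (∈-downFrom⁻ r∈)) (∈-downFrom⁻ r∈)))
  length-filter : length (filter (_<? t) D) ≡ length D
  length-filter = trans (cong length filter≡) (trans (length-downFrom t) (sym length≡t))

-- The last t entries form a strictly decreasing list of length t that must contain all of [0, t).
beta-unshift : ∀ {f} K t {T} → Antitone f → beta f (K + t) ∼ shiftBeta t T →
               (∀ {i} → i < t → f (K + i) ≡ 0) × beta f K ∼ T
beta-unshift {f} K t {T} f↘ X∼ = beta-injective t (trans D≡downFrom (sym (beta-zero t))) , head∼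
  where
  D : List ℕ
  D = beta (λ i → f (K + i)) t
  small∈D : ∀ {r} → r < t → r ∈ D
  small∈D {r} r<t
    with ∈-++⁻ (map (t +_) (beta f K)) (subst (r ∈_) (beta-++ f K t) (from X∼ (∈-++⁺ʳ _ (∈-downFrom⁺ r<t))))
  ... | inj₁ ∈shifted with y , _ , refl ← ∈-map⁻ (t +_) ∈shifted = ⊥-elim (m+n≮m t y r<t)
  ... | inj₂ ∈D = ∈D
  D≡downFrom : D ≡ downFrom t
  D≡downFrom = strict-downFrom (beta-strict t (antitone-shift K f↘)) (length-beta _ t) small∈D
  head∼ : beta f K ∼ T
  head∼ = shiftBeta-cancel t (begin
    shiftBeta t (beta f K)       ≡⟨ cong (map (t +_) (beta f K) ++_) D≡downFrom ⟨
    map (t +_) (beta f K) ++ D   ≡⟨ beta-++ f K t ⟨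
    beta f (K + t)               ≈⟨ X∼ ⟩
    shiftBeta t T                ∎)
    where open ∼-Reasoning

sum-beta : ∀ xs K → VanishesFrom K (part xs) → sum xs + sum (downFrom K) ≡ sum (beta (part xs) K)
sum-beta []       K       _        = cong sum (sym (beta-zero K))
sum-beta (x ∷ xs) zero    vanishes rewrite vanishes 0 z≤n = sum-beta xs 0 (λ i _ → vanishes (suc i) z≤n)
sum-beta (x ∷ xs) (suc K) vanishes =
  trans (regroup x (sum xs) K (sum (downFrom K)))
        (cong (x + K +_) (sum-beta xs K (λ i K≤i → vanishes (suc i) (s≤s K≤i))))
  where
  regroup : ∀ x s K d → x + s + (K + d) ≡ x + K + (s + d)
  regroup = solve-∀

gauss : ∀ K → sum (downFrom K) + sum (downFrom K) + K ≡ K * K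
gauss zero    = refl
gauss (suc K) = trans (regroup K (sum (downFrom K))) (trans (cong (_+ (2 * K + 1)) (gauss K)) (square K))
  where
  regroup : ∀ K s → K + s + (K + s) + suc K ≡ s + s + K + (2 * K + 1)
  regroup = solve-∀
  square : ∀ K → K * K + (2 * K + 1) ≡ suc K * suc K
  square = solve-∀

-- Reflection

reflect : ℕ → List ℕ → List ℕ
reflect c xs = map (λ x → c ∸ suc x) (reverse xs)

length-reflect : ∀ c xs → length (reflect c xs) ≡ length xs
length-reflect c xs = trans (length-map _ (reverse xs)) (length-reverse xs)

part-reflect : ∀ c xs {i j} → suc (i + j) ≡ length xs → part (reflect c xs) i ≡ c ∸ suc (part xs j)
part-reflect c xs {i} {j} i+j≡ = trans (part-map _ (reverse xs) i<) (cong (λ x → c ∸ suc x) (part-reverse xs i+j≡))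
  where
  i< : i < length (reverse xs)
  i< = subst (i <_) (trans i+j≡ (sym (length-reverse xs))) (s≤s (m≤m+n i j))

∈-reflect⁺ : ∀ c {x xs} → x ∈ xs → c ∸ suc x ∈ reflect c xs
∈-reflect⁺ c x∈ = ∈-map⁺ (λ x → c ∸ suc x) (reverse⁺ x∈)

∈-reflect⁻ : ∀ c {y} xs → y ∈ reflect c xs → ∃ λ x → x ∈ xs × y ≡ c ∸ suc x
∈-reflect⁻ c xs y∈ with x , x∈ , y≡ ← ∈-map⁻ (λ x → c ∸ suc x) y∈ = x , reverse⁻ x∈ , y≡

reflect-involutive : ∀ {c x} → x < c → c ∸ suc (c ∸ suc x) ≡ x
reflect-involutive {x = x} x<c with d , refl ← m≤n⇒∃[o]m+o≡n x<c rewrite m+n∸m≡n (suc x) d = m+n∸n≡m x d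

reflect-strict : ∀ {c xs} → Linked _>_ xs → All (_< c) xs → Linked _>_ (reflect c xs)
reflect-strict xs↘ xs<c =
  map⁺-on (λ _ y<c x<y → ∸-monoʳ-< (s≤s x<y) y<c) (All.tabulate (All.lookup xs<c ∘ reverse⁻)) (Linked-reverse xs↘)

beta-complement : ∀ {f g} M K → (∀ {i j} → suc (i + j) ≡ K → g i + f j ≡ M) →
                  reflect (M + K) (beta f K) ≡ beta g K
beta-complement {f} {g} M K complement = part-ext _ _ (trans length≡K (sym (length-beta g K))) parts
  where
  length≡K : length (reflect (M + K) (beta f K)) ≡ K
  length≡K = trans (length-reflect (M + K) (beta f K)) (length-beta f K)
  regroup : ∀ a b i j → a + b + suc (i + j) ≡ suc (b + i) + (a + j)
  regroup = solve-∀
  parts : ∀ i → i < length (reflect (M + K) (beta f K)) →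
          part (reflect (M + K) (beta f K)) i ≡ part (beta g K) i
  parts i i< with j , i+j≡K ← m≤n⇒∃[o]m+o≡n (subst (i <_) length≡K i<) = begin
    part (reflect (M + K) (beta f K)) i
      ≡⟨ part-reflect (M + K) (beta f K) (trans i+j≡K (sym (length-beta f K))) ⟩
    M + K ∸ suc (part (beta f K) j)
      ≡⟨ cong (λ x → M + K ∸ suc x) (part-beta f K (trans (cong suc (+-comm j i)) i+j≡K)) ⟩
    M + K ∸ suc (f j + i)
      ≡⟨ cong₂ (λ a b → a + b ∸ suc (f j + i)) (sym (complement i+j≡K)) (sym i+j≡K) ⟩
    g i + f j + suc (i + j) ∸ suc (f j + i)    ≡⟨ cong (_∸ suc (f j + i)) (regroup (g i) (f j) i j) ⟩
    suc (f j + i) + (g i + j) ∸ suc (f j + i)  ≡⟨ m+n∸m≡n (suc (f j + i)) (g i + j) ⟩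
    g i + j                                    ≡⟨ part-beta g K i+j≡K ⟨
    part (beta g K) i                          ∎
    where open ≡-Reasoning

ReflectionClosed : ℕ → List ℕ → Set
ReflectionClosed c xs = ∀ {x} → x ∈ xs → x < c × c ∸ suc x ∈ xs

ReflectionClosed-resp-∼ : ∀ {c xs ys} → xs ∼ ys → ReflectionClosed c ys → ReflectionClosed c xs
ReflectionClosed-resp-∼ xs∼ys closed x∈ with x<c , x′∈ ← closed (to xs∼ys x∈) = x<c , from xs∼ys x′∈

closed⇒reflect≡ : ∀ {c xs} → Linked _>_ xs → ReflectionClosed c xs → reflect c xs ≡ xs
closed⇒reflect≡ {c} {xs} xs↘ closed =
  strict-≡ (reflect-strict xs↘ (All.tabulate (proj₁ ∘ closed))) xs↘ (mk⇔ to′ from′)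
  where
  to′ : ∀ {y} → y ∈ reflect c xs → y ∈ xs
  to′ y∈ with x , x∈ , refl ← ∈-reflect⁻ c xs y∈ = proj₂ (closed x∈)
  from′ : ∀ {x} → x ∈ xs → x ∈ reflect c xs
  from′ x∈ with x<c , x′∈ ← closed x∈ = subst (_∈ reflect c xs) (reflect-involutive x<c) (∈-reflect⁺ c x′∈)

reflect-pairs : ∀ {c} xs → reflect c xs ≡ xs → All (_< c) xs →
                ∀ {i j} → suc (i + j) ≡ length xs → part xs i + suc (part xs j) ≡ c
reflect-pairs {c} xs fixed xs<c {i} {j} i+j≡ = begin
  part xs i + suc (part xs j)              ≡⟨ cong (λ ys → part ys i + suc (part xs j)) (sym fixed) ⟩
  part (reflect c xs) i + suc (part xs j)  ≡⟨ cong (_+ suc (part xs j)) (part-reflect c xs i+j≡) ⟩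
  c ∸ suc (part xs j) + suc (part xs j)    ≡⟨ m∸n+n≡m (All.lookup xs<c (∈-part xs j<)) ⟩
  c                                        ∎
  where
  open ≡-Reasoning
  j< : j < length xs
  j< = subst (j <_) i+j≡ (s≤s (m≤n+m j i))

sum-reflect : ∀ {c} xs → All (_< c) xs → sum (reflect c xs) + sum xs + length xs ≡ length xs * c
sum-reflect {c} xs xs<c =
  trans (cong (λ s → s + sum xs + length xs) (sum-↭ (map⁺ _ (↭-reverse xs)))) (pairs xs xs<c)
  where
  pairs : ∀ xs → All (_< c) xs → sum (map (λ x → c ∸ suc x) xs) + sum xs + length xs ≡ length xs * c
  pairs []       []           = refl
  pairs (x ∷ xs) (x<c ∷ xs<c) =
    trans (regroup (c ∸ suc x) (sum (map (λ x → c ∸ suc x) xs)) x (sum xs) (length xs))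
          (cong₂ _+_ (m∸n+n≡m x<c) (pairs xs xs<c))
    where
    regroup : ∀ a s x t l → a + s + (x + t) + suc l ≡ a + suc x + (s + t + l)
    regroup = solve-∀

-- Merging beta sets by parity

mod2 : ∀ x → x % 2 ≡ 0 ⊎ x % 2 ≡ 1
mod2 x with x % 2 | m%n<n x 2
... | 0           | _              = inj₁ refl
... | 1           | _              = inj₂ refl
... | suc (suc _) | s≤s (s≤s ())

halve : ∀ x → x % 2 + 2 * (x / 2) ≡ x
halve x = trans (cong (x % 2 +_) (*-comm 2 (x / 2))) (sym (m≡m%n+[m/n]*n x 2))

parity-halves : ∀ {k} x → x % 2 ≡ k → k + 2 * ((x ∸ k) / 2) ≡ x
parity-halves x refl = begin
  x % 2 + 2 * ((x ∸ x % 2) / 2)  ≡⟨ cong (λ y → x % 2 + 2 * (y / 2)) x∸x%2 ⟩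
  x % 2 + 2 * ((x / 2) * 2 / 2)  ≡⟨ cong (λ y → x % 2 + 2 * y) (m*n/n≡m (x / 2) 2) ⟩
  x % 2 + 2 * (x / 2)            ≡⟨ halve x ⟩
  x                              ∎
  where
  open ≡-Reasoning
  x∸x%2 : x ∸ x % 2 ≡ (x / 2) * 2
  x∸x%2 = trans (cong (_∸ x % 2) (m≡m%n+[m/n]*n x 2)) (m+n∸m≡n (x % 2) _)

odd<double : ∀ {y c} → y < c → 1 + 2 * y < 2 * c
odd<double {y} {c} y<c = subst (_≤ 2 * c) (*-suc 2 y) (*-monoʳ-≤ 2 y<c)

double≤ : ∀ {x y} → 2 * x ≤ x + y → x ≤ y
double≤ {x} {y} 2x≤ = +-cancelˡ-≤ x x y (subst (_≤ x + y) (cong (x +_) (+-identityʳ x)) 2x≤)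

reflect-even : ∀ {c x} → x < c → 2 * c ∸ suc (2 * x) ≡ 1 + 2 * (c ∸ suc x)
reflect-even {x = x} x<c with d , refl ← m≤n⇒∃[o]m+o≡n x<c rewrite m+n∸m≡n (suc x) d =
  trans (cong (_∸ suc (2 * x)) (double x d)) (m+n∸m≡n (suc (2 * x)) (1 + 2 * d))
  where
  double : ∀ x d → 2 * (suc x + d) ≡ suc (2 * x) + (1 + 2 * d)
  double = solve-∀

reflect-odd : ∀ c y → 2 * c ∸ suc (1 + 2 * y) ≡ 2 * (c ∸ suc y)
reflect-odd c y = trans (cong (2 * c ∸_) (sym (*-suc 2 y))) (sym (*-distribˡ-∸ 2 c (suc y)))

-- The beta set whose 2-quotient beta sets (ξ^(0) and ξ^(1) of the paper) are xs and ys.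
merge : List ℕ → List ℕ → List ℕ
merge xs ys = map (2 *_) xs ++ map (λ y → 1 + 2 * y) ys

parityPart : ℕ → List ℕ → List ℕ
parityPart k xs = map (λ x → (x ∸ k) / 2) (filter (λ x → x % 2 ≟ k) xs)

parity-split : ∀ xs → xs ∼ merge (parityPart 0 xs) (parityPart 1 xs)
parity-split xs = mk⇔ to′ from′
  where
  to′ : ∀ {x} → x ∈ xs → x ∈ merge (parityPart 0 xs) (parityPart 1 xs)
  to′ {x} x∈ with mod2 x
  ... | inj₁ even = subst (_∈ _) (parity-halves x even)
                      (∈-++⁺ˡ (∈-map⁺ (2 *_) (∈-map⁺ (λ x → x / 2) (∈-filter⁺ (λ x → x % 2 ≟ 0) x∈ even))))
  ... | inj₂ odd  = subst (_∈ _) (parity-halves x odd)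
                      (∈-++⁺ʳ _ (∈-map⁺ (λ y → 1 + 2 * y)
                        (∈-map⁺ (λ x → (x ∸ 1) / 2) (∈-filter⁺ (λ x → x % 2 ≟ 1) x∈ odd))))
  from-part : ∀ k {z} → z ∈ map (λ y → k + 2 * y) (parityPart k xs) → z ∈ xs
  from-part k z∈ with y , y∈ , refl ← ∈-map⁻ (λ y → k + 2 * y) z∈
                 with x , x∈ , refl ← ∈-map⁻ (λ x → (x ∸ k) / 2) y∈
                 with x∈xs , x-parity ← ∈-filter⁻ (λ x → x % 2 ≟ k) x∈ =
    subst (_∈ xs) (sym (parity-halves x x-parity)) x∈xs
  from′ : ∀ {z} → z ∈ merge (parityPart 0 xs) (parityPart 1 xs) → z ∈ xs
  from′ z∈ with ∈-++⁻ (map (2 *_) (parityPart 0 xs)) z∈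
  ... | inj₁ ∈evens = from-part 0 ∈evens
  ... | inj₂ ∈odds  = from-part 1 ∈odds

parityPart-strict : ∀ k {xs} → Linked _>_ xs → Linked _>_ (parityPart k xs)
parityPart-strict k {xs} xs↘ =
  map⁺-on halves-mono (all-filter (λ x → x % 2 ≟ k) xs)
          (Linked-filter⁺ (λ x → x % 2 ≟ k) (λ p q → <-trans q p) xs↘)
  where
  halves-mono : ∀ {x y} → x % 2 ≡ k → y % 2 ≡ k → x > y → (x ∸ k) / 2 > (y ∸ k) / 2
  halves-mono {x} {y} x-parity y-parity y<x =
    *-cancelˡ-< 2 _ _ (+-cancelˡ-< k _ _
      (subst₂ _<_ (sym (parity-halves y y-parity)) (sym (parity-halves x x-parity)) y<x))

length-parityParts : ∀ xs → length (parityPart 0 xs) + length (parityPart 1 xs) ≡ length xs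
length-parityParts xs =
  trans (cong₂ _+_ (length-map _ (filter (λ x → x % 2 ≟ 0) xs)) (length-map _ (filter (λ x → x % 2 ≟ 1) xs)))
        (length-filters xs)
  where
  length-filters : ∀ xs → length (filter (λ x → x % 2 ≟ 0) xs) + length (filter (λ x → x % 2 ≟ 1) xs) ≡ length xs
  length-filters []       = refl
  length-filters (x ∷ xs) with mod2 x
  ... | inj₁ even rewrite even = cong suc (length-filters xs)
  ... | inj₂ odd  rewrite odd  = trans (+-suc _ _) (cong suc (length-filters xs))

merge-downFrom : ∀ t → merge (downFrom t) (downFrom t) ∼ downFrom (2 * t)
merge-downFrom t = mk⇔ to′ from′
  where
  to′ : ∀ {z} → z ∈ merge (downFrom t) (downFrom t) → z ∈ downFrom (2 * t)
  to′ z∈ with ∈-++⁻ (map (2 *_) (downFrom t)) z∈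
  ... | inj₁ ∈evens with y , y∈ , refl ← ∈-map⁻ (2 *_) ∈evens = ∈-downFrom⁺ (*-monoʳ-< 2 (∈-downFrom⁻ y∈))
  ... | inj₂ ∈odds with y , y∈ , refl ← ∈-map⁻ (λ y → 1 + 2 * y) ∈odds = ∈-downFrom⁺ (odd<double (∈-downFrom⁻ y∈))
  half∈ : ∀ {z} k h → z < 2 * t → k + 2 * h ≡ z → h ∈ downFrom t
  half∈ k h z<2t z≡ =
    ∈-downFrom⁺ (*-cancelˡ-< 2 h t (≤-<-trans (m≤n+m (2 * h) k) (subst (_< 2 * t) (sym z≡) z<2t)))
  from′ : ∀ {z} → z ∈ downFrom (2 * t) → z ∈ merge (downFrom t) (downFrom t)
  from′ {z} z∈ with mod2 z
  ... | inj₁ even = subst (_∈ _) (parity-halves z even)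
                      (∈-++⁺ˡ (∈-map⁺ (2 *_) (half∈ 0 (z / 2) (∈-downFrom⁻ z∈) (parity-halves z even))))
  ... | inj₂ odd  = subst (_∈ _) (parity-halves z odd)
                      (∈-++⁺ʳ _ (∈-map⁺ (λ y → 1 + 2 * y)
                        (half∈ 1 ((z ∸ 1) / 2) (∈-downFrom⁻ z∈) (parity-halves z odd))))

merge-shiftBeta : ∀ t xs ys → merge (shiftBeta t xs) (shiftBeta t ys) ∼ shiftBeta (2 * t) (merge xs ys)
merge-shiftBeta t xs ys = begin
  merge (shiftBeta t xs) (shiftBeta t ys)
    ≡⟨ cong₂ _++_ (map-++ (2 *_) (map (t +_) xs) (downFrom t)) (map-++ odd (map (t +_) ys) (downFrom t)) ⟩
  (map (2 *_) (map (t +_) xs) ++ map (2 *_) (downFrom t)) ++ (map odd (map (t +_) ys) ++ map odd (downFrom t))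
    ≈⟨ interchange commutativeSemigroup (map (2 *_) (map (t +_) xs)) (map (2 *_) (downFrom t))
                                        (map odd (map (t +_) ys)) (map odd (downFrom t)) ⟩
  (map (2 *_) (map (t +_) xs) ++ map odd (map (t +_) ys)) ++ merge (downFrom t) (downFrom t)
    ≈⟨ ++-cong (∼.reflexive shifted) (merge-downFrom t) ⟩
  shiftBeta (2 * t) (merge xs ys) ∎
  where
  open ∼-Reasoning
  open CommutativeMonoid (commutativeMonoid SymmetricKind.equivalence ℕ) using (commutativeSemigroup)
  odd : ℕ → ℕ
  odd y = 1 + 2 * y
  odd-shift : ∀ t y → 1 + 2 * (t + y) ≡ 2 * t + (1 + 2 * y)
  odd-shift = solve-∀
  commute : ∀ (g : ℕ → ℕ) → (∀ x → g (t + x) ≡ 2 * t + g x) →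
            ∀ zs → map g (map (t +_) zs) ≡ map (2 * t +_) (map g zs)
  commute g g-shift zs = trans (sym (map-∘ zs)) (trans (map-≗ g-shift zs) (map-∘ zs))
  shifted : map (2 *_) (map (t +_) xs) ++ map odd (map (t +_) ys) ≡ map (2 * t +_) (merge xs ys)
  shifted = trans (cong₂ _++_ (commute (2 *_) (*-distribˡ-+ 2 t) xs) (commute odd (odd-shift t) ys))
                  (sym (map-++ (2 * t +_) (map (2 *_) xs) (map odd ys)))

merge-reflect-closed : ∀ {c} xs → All (_< c) xs → ReflectionClosed (2 * c) (merge xs (reflect c xs))
merge-reflect-closed {c} xs xs<c {z} z∈ with ∈-++⁻ (map (2 *_) xs) z∈
... | inj₁ ∈evens with x , x∈ , refl ← ∈-map⁻ (2 *_) ∈evens =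
  *-monoʳ-< 2 x<c ,
  subst (_∈ merge xs (reflect c xs)) (sym (reflect-even x<c))
        (∈-++⁺ʳ (map (2 *_) xs) (∈-map⁺ (λ y → 1 + 2 * y) (∈-reflect⁺ c x∈)))
  where
  x<c : x < c
  x<c = All.lookup xs<c x∈
... | inj₂ ∈odds with y , y∈ , refl ← ∈-map⁻ (λ y → 1 + 2 * y) ∈odds
                 with x , x∈ , refl ← ∈-reflect⁻ c xs y∈ =
  odd<double (∸-monoʳ-< (s≤s z≤n) x<c) ,
  subst (_∈ merge xs (reflect c xs)) (sym (trans (reflect-odd c (c ∸ suc x)) (cong (2 *_) (reflect-involutive x<c))))
        (∈-++⁺ˡ (∈-map⁺ (2 *_) x∈))
  where
  x<c : x < c
  x<c = All.lookup xs<c x∈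

-- With 2(n + L) beta numbers, the beta set of f is [0, 2L) together with 2L + (the merged n-element
-- beta sets of A and B); stripping the block [0, 2L) leaves 2n beta numbers.
remove-block : ∀ {f A B} L n → Antitone f → VanishesFrom (2 * L) f →
               VanishesFrom L A → VanishesFrom L B → VanishesFrom n A → VanishesFrom n B →
               beta f (2 * L) ∼ merge (beta A L) (beta B L) →
               VanishesFrom (2 * n) f × beta f (2 * n) ∼ merge (beta A n) (beta B n)
remove-block {f} {A} {B} L n f↘ f-2L A-L B-L A-n B-n f∼ = vanishes , proj₂ unshifted
  where
  open ∼-Reasoning
  X∼ : beta f (2 * n + 2 * L) ∼ shiftBeta (2 * L) (merge (beta A n) (beta B n))
  X∼ = begin
    beta f (2 * n + 2 * L)                                   ≡⟨ cong (beta f) (+-comm (2 * n) (2 * L)) ⟩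
    beta f (2 * L + 2 * n)                                   ≡⟨ beta-+ (2 * L) (2 * n) f-2L ⟩
    shiftBeta (2 * n) (beta f (2 * L))                       ≈⟨ shiftBeta-cong (2 * n) f∼ ⟩
    shiftBeta (2 * n) (merge (beta A L) (beta B L))          ≈⟨ merge-shiftBeta n (beta A L) (beta B L) ⟨
    merge (shiftBeta n (beta A L)) (shiftBeta n (beta B L))
      ≡⟨ cong₂ merge (shiftBeta-swap L n A-L A-n) (shiftBeta-swap L n B-L B-n) ⟩
    merge (shiftBeta L (beta A n)) (shiftBeta L (beta B n))  ≈⟨ merge-shiftBeta L (beta A n) (beta B n) ⟩
    shiftBeta (2 * L) (merge (beta A n) (beta B n))          ∎
  unshifted : (∀ {i} → i < 2 * L → f (2 * n + i) ≡ 0) × beta f (2 * n) ∼ merge (beta A n) (beta B n)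
  unshifted = beta-unshift (2 * n) (2 * L) f↘ X∼
  vanishes : VanishesFrom (2 * n) f
  vanishes i 2n≤i with r , refl ← m≤n⇒∃[o]m+o≡n 2n≤i with r <? 2 * L
  ... | yes r<2L = proj₁ unshifted r<2L
  ... | no  r≮2L = f-2L (2 * n + r) (≤-trans (≮⇒≥ r≮2L) (m≤n+m r (2 * n)))

-- The 2-quotient of μ

zipWith-+-downFrom : ∀ xs → zipWith _+_ xs (downFrom (length xs)) ≡ beta (part xs) (length xs)
zipWith-+-downFrom []       = refl
zipWith-+-downFrom (x ∷ xs) = cong (x + length xs ∷_) (zipWith-+-downFrom xs)

zipWith-∸-downFrom : ∀ {xs} → Linked _>_ xs →
                     beta (part (zipWith _∸_ xs (downFrom (length xs)))) (length xs) ≡ xs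
zipWith-∸-downFrom {[]}     _   = refl
zipWith-∸-downFrom {x ∷ xs} xs↘ =
  cong₂ _∷_ (m∸n+n≡m (strict-length xs↘)) (zipWith-∸-downFrom (Linked.tail xs↘))

part-++-zeros : ∀ xs k i → part (xs ++ replicate k 0) i ≡ part xs i
part-++-zeros []       zero    i       = refl
part-++-zeros []       (suc k) zero    = refl
part-++-zeros []       (suc k) (suc i) = part-++-zeros [] k i
part-++-zeros (x ∷ xs) k       zero    = refl
part-++-zeros (x ∷ xs) k       (suc i) = part-++-zeros xs k i

ξ≡beta : ∀ xs → ξ xs ≡ beta (part xs) (evenLen xs)
ξ≡beta xs = begin
  zipWith _+_ (pad xs N) (downFrom N)                    ≡⟨ cong (zipWith _+_ (pad xs N) ∘ downFrom) (sym length-pad) ⟩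
  zipWith _+_ (pad xs N) (downFrom (length (pad xs N)))  ≡⟨ zipWith-+-downFrom (pad xs N) ⟩
  beta (part (pad xs N)) (length (pad xs N))             ≡⟨ cong (beta (part (pad xs N))) length-pad ⟩
  beta (part (pad xs N)) N                               ≡⟨ beta-cong N (part-++-zeros xs (N ∸ length xs)) ⟩
  beta (part xs) N                                       ∎
  where
  open ≡-Reasoning
  N : ℕ
  N = evenLen xs
  length-pad : length (pad xs N) ≡ N
  length-pad = trans (length-++ xs) (trans (cong (length xs +_) (length-replicate (N ∸ length xs)))
                                           (m+[n∸m]≡n (m≤m+n (length xs) (length xs % 2))))

evenLen-even : ∀ xs → evenLen xs ≡ 2 * (length xs / 2 + length xs % 2)
evenLen-even xs = trans (cong (_+ length xs % 2) (sym (halve (length xs)))) (regroup (length xs % 2) (length xs / 2))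
  where
  regroup : ∀ r q → r + 2 * q + r ≡ 2 * (q + r)
  regroup = solve-∀

ξk-strict : ∀ k {μ} → IsPartition μ → Linked _>_ (ξk μ k)
ξk-strict k {μ} μ↘ = parityPart-strict k (subst (Linked _>_) (sym (ξ≡beta μ)) (beta-strict _ (part-antitone μ↘)))

ξk≡beta : ∀ k {μ} γ → IsPartition μ → quot2 μ k ≈ₚ γ → ξk μ k ≡ beta (part γ) (length (ξk μ k))
ξk≡beta k γ μ↘ q≈γ = trans (sym (zipWith-∸-downFrom (ξk-strict k μ↘))) (beta-cong _ q≈γ)

quot2-vanishes : ∀ k μ γ → quot2 μ k ≈ₚ γ → VanishesFrom (length (ξk μ k)) (part γ)
quot2-vanishes k μ γ q≈γ i len≤i = trans (sym (q≈γ i)) (part-beyond (quot2 μ k) (≤-trans length-quot2 len≤i))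
  where
  length-quot2 : length (quot2 μ k) ≤ length (ξk μ k)
  length-quot2 = subst (_≤ length (ξk μ k)) (sym (length-zipWith _∸_ (ξk μ k) _)) (m⊓n≤m _ _)

length-ξk : ∀ μ → length (ξk μ 0) + length (ξk μ 1) ≡ evenLen μ
length-ξk μ = trans (length-parityParts (ξ μ)) (trans (cong length (ξ≡beta μ)) (length-beta _ (evenLen μ)))

top-even≤ : ∀ a b → (∀ {z} → z ∈ map (2 *_) (upTo a) → z < a + b) → a ≤ suc b
top-even≤ zero    b _     = z≤n
top-even≤ (suc a) b below = s≤s (double≤ (≤-pred (below (∈-map⁺ (2 *_) (∈-upTo⁺ (n<1+n a))))))

top-odd≤ : ∀ a b → (∀ {z} → z ∈ map (λ s → 2 * s + 1) (upTo b) → z < a + b) → b ≤ a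
top-odd≤ a zero    _     = z≤n
top-odd≤ a (suc b) below = double≤ (subst₂ _≤_ (next-even b) (+-comm a (suc b)) bound)
  where
  next-even : ∀ b → suc (2 * b + 1) ≡ 2 * suc b
  next-even = solve-∀
  bound : 2 * b + 1 < a + suc b
  bound = below (∈-map⁺ (λ s → 2 * s + 1) (∈-upTo⁺ (n<1+n b)))

equal-parities : ∀ a b {q} → a + b ≡ 2 * q →
                 (∀ {z} → z ∈ map (2 *_) (upTo a) ++ map (λ s → 2 * s + 1) (upTo b) → z < a + b) → a ≡ b
equal-parities a b {q} a+b≡2q below with m≤n⇒m<n∨m≡n (top-even≤ a b (below ∘ ∈-++⁺ˡ))
... | inj₁ a<1+b = ≤-antisym (≤-pred a<1+b) (top-odd≤ a b (below ∘ ∈-++⁺ʳ _))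
... | inj₂ refl  = contradiction (trans (sym a+b≡2q) (cong suc (cong (b +_) (sym (+-identityʳ b))))) (even≢odd q b)

below-head : ∀ {ys N} → Linked _≥_ ys → length ys ≡ N → part (zipWith _∸_ ys (downFrom N)) 0 ≡ 0 →
             ∀ {z} → z ∈ ys → z < N
below-head {y ∷ ys} ys↘ refl y≤ z∈ =
  s≤s (≤-trans (All.lookup (Linked⇒All {R = _≥_} (λ x≥y y≥z → ≤-trans y≥z x≥y) ≤-refl ys↘) z∈) (m∸n≡0⇒m≤n y≤))

-- The head of ξ̃ is the larger of 2(a − 1) and 2b − 1; an empty core forces it below a + b.
emptyCore⇒equal-lengths : ∀ μ → EmptyCore2 μ → length (ξk μ 0) ≡ length (ξk μ 1)
emptyCore⇒equal-lengths μ core =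
  equal-parities a b {length μ / 2 + length μ % 2} (trans a+b≡N (evenLen-even μ)) below
  where
  a : ℕ
  a = length (ξk μ 0)
  b : ℕ
  b = length (ξk μ 1)
  N : ℕ
  N = evenLen μ
  Z : List ℕ
  Z = map (2 *_) (upTo a) ++ map (λ s → 2 * s + 1) (upTo b)
  a+b≡N : a + b ≡ N
  a+b≡N = length-ξk μ
  length-ξ̃ : length (ξ̃ μ) ≡ N
  length-ξ̃ = begin
    length (reverse (sort Z))  ≡⟨ length-reverse (sort Z) ⟩
    length (sort Z)            ≡⟨ ↭-length (sort-↭ Z) ⟩
    length Z                   ≡⟨ length-++ (map (2 *_) (upTo a)) ⟩
    length (map (2 *_) (upTo a)) + length (map (λ s → 2 * s + 1) (upTo b))
      ≡⟨ cong₂ _+_ (trans (length-map _ (upTo a)) (length-upTo a)) (trans (length-map _ (upTo b)) (length-upTo b)) ⟩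
    a + b                      ≡⟨ a+b≡N ⟩
    N                          ∎
    where open ≡-Reasoning
  below : ∀ {z} → z ∈ Z → z < a + b
  below {z} z∈ = subst (z <_) (sym a+b≡N)
    (below-head (Linked-reverse (sort-↗ Z)) length-ξ̃ (core 0) (reverse⁺ (∈-resp-↭ (↭-sym (sort-↭ Z)) z∈)))

two-quotient-beta : ∀ μ α β → IsPartition μ → EmptyCore2 μ → quot2 μ 0 ≈ₚ α → quot2 μ 1 ≈ₚ β →
                    ∃ λ L → VanishesFrom (2 * L) (part μ) × VanishesFrom L (part α) × VanishesFrom L (part β) ×
                            beta (part μ) (2 * L) ∼ merge (beta (part α) L) (beta (part β) L)
two-quotient-beta μ α β μ↘ core q₀ q₁ =
  L , μ-vanishes , quot2-vanishes 0 μ α q₀ ,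
  subst (λ b → VanishesFrom b (part β)) (sym L≡b) (quot2-vanishes 1 μ β q₁) , μ∼
  where
  L : ℕ
  L = length (ξk μ 0)
  L≡b : L ≡ length (ξk μ 1)
  L≡b = emptyCore⇒equal-lengths μ core
  N≡2L : evenLen μ ≡ 2 * L
  N≡2L = trans (sym (length-ξk μ)) (cong (L +_) (trans (sym L≡b) (sym (+-identityʳ L))))
  μ-vanishes : VanishesFrom (2 * L) (part μ)
  μ-vanishes i 2L≤i = part-beyond μ (≤-trans (m≤m+n (length μ) (length μ % 2)) (subst (_≤ i) (sym N≡2L) 2L≤i))
  μ∼ : beta (part μ) (2 * L) ∼ merge (beta (part α) L) (beta (part β) L)
  μ∼ = begin
    beta (part μ) (2 * L)                      ≡⟨ cong (beta (part μ)) N≡2L ⟨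
    beta (part μ) (evenLen μ)                  ≡⟨ ξ≡beta μ ⟨
    ξ μ                                        ≈⟨ parity-split (ξ μ) ⟩
    merge (ξk μ 0) (ξk μ 1)
      ≡⟨ cong₂ merge (ξk≡beta 0 α μ↘ q₀) (trans (ξk≡beta 1 β μ↘ q₁) (cong (beta (part β)) (sym L≡b))) ⟩
    merge (beta (part α) L) (beta (part β) L)  ∎
    where open ∼-Reasoning

-- Balanced partitions

complementary-closed : ∀ n m α β → Complementary n m α β →
                       ReflectionClosed (2 * (m + n)) (merge (beta (part α) n) (beta (part β) n))
complementary-closed n m α β (_ , α≤m , _ , β≡m∸α) =
  subst (λ ys → ReflectionClosed (2 * (m + n)) (merge (beta (part α) n) ys))
        (beta-complement m n complement) (merge-reflect-closed (beta (part α) n) (All.tabulate bound))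
  where
  complement : ∀ {i j} → suc (i + j) ≡ n → part β i + part α j ≡ m
  complement {i} {j} refl = begin
    part β i + part α j                ≡⟨ cong (_+ part α j) (β≡m∸α i (s≤s (m≤m+n i j))) ⟩
    m ∸ part α (i + j ∸ i) + part α j  ≡⟨ cong (λ k → m ∸ part α k + part α j) (m+n∸m≡n i j) ⟩
    m ∸ part α j + part α j            ≡⟨ m∸n+n≡m (α≤m j) ⟩
    m                                  ∎
    where open ≡-Reasoning
  bound : ∀ {x} → x ∈ beta (part α) n → x < m + n
  bound x∈ with i , j , refl , refl ← ∈-beta⁻ (part α) n x∈ = +-mono-≤-< (α≤m i) (s≤s (m≤n+m j i))

-- Beta numbers at mirror positions add up to 2(m + n) − 1 exactly when the parts there add up to 2m.
balanced-criterion : ∀ {n m μ} → IsPartition μ → VanishesFrom (2 * n) (part μ) →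
                     ReflectionClosed (2 * (m + n)) (beta (part μ) (2 * n)) → Balanced n m μ
balanced-criterion {n} {m} {μ} μ↘ vanishes closed = vanishes , total , λ i i<n → pair (mirror i<n)
  where
  f : ℕ → ℕ
  f = part μ
  X : List ℕ
  X = beta f (2 * n)
  X<c : All (_< 2 * (m + n)) X
  X<c = All.tabulate (proj₁ ∘ closed)
  fixed : reflect (2 * (m + n)) X ≡ X
  fixed = closed⇒reflect≡ (beta-strict (2 * n) (part-antitone μ↘)) closed
  pair : ∀ {i j} → suc (i + j) ≡ 2 * n → f i + f j ≡ 2 * m
  pair {i} {j} i+j≡ = +-cancelʳ-≡ (2 * n) _ _ (begin
    f i + f j + 2 * n          ≡⟨ cong (f i + f j +_) (sym i+j≡) ⟩
    f i + f j + suc (i + j)    ≡⟨ regroup (f i) (f j) i j ⟩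
    f i + j + suc (f j + i)    ≡⟨ cong₂ (λ x y → x + suc y) (part-beta f _ i+j≡) (part-beta f _ j+i≡) ⟨
    part X i + suc (part X j)  ≡⟨ reflect-pairs X fixed X<c (trans i+j≡ (sym (length-beta f (2 * n)))) ⟩
    2 * (m + n)                ≡⟨ *-distribˡ-+ 2 m n ⟩
    2 * m + 2 * n              ∎)
    where
    open ≡-Reasoning
    j+i≡ : suc (j + i) ≡ 2 * n
    j+i≡ = trans (cong suc (+-comm j i)) i+j≡
    regroup : ∀ a b i j → a + b + suc (i + j) ≡ a + j + suc (b + i)
    regroup = solve-∀
  mirror : ∀ {i} → i < n → suc (i + (2 * n ∸ 1 ∸ i)) ≡ 2 * n
  mirror {i} i<n = trans (cong (suc i +_) (∸-+-assoc (2 * n) 1 i)) (m+[n∸m]≡n (≤-trans i<n (m≤m+n n (n + 0))))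
  total : sum μ ≡ 2 * n * m
  total = *-cancelˡ-≡ (sum μ) (2 * n * m) 2 (+-cancelʳ-≡ (2 * n * (2 * n)) _ _ (begin
    2 * sum μ + 2 * n * (2 * n)                       ≡⟨ cong (2 * sum μ +_) (gauss (2 * n)) ⟨
    2 * sum μ + (sum D + sum D + 2 * n)               ≡⟨ regroup (sum μ) (sum D) (2 * n) ⟩
    (sum μ + sum D) + (sum μ + sum D) + 2 * n         ≡⟨ cong (λ s → s + s + 2 * n) (sum-beta μ (2 * n) vanishes) ⟩
    sum X + sum X + 2 * n                             ≡⟨ cong (λ ys → sum ys + sum X + 2 * n) fixed ⟨
    sum (reflect (2 * (m + n)) X) + sum X + 2 * n     ≡⟨ cong (sum (reflect (2 * (m + n)) X) + sum X +_) length-X ⟨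
    sum (reflect (2 * (m + n)) X) + sum X + length X  ≡⟨ sum-reflect X X<c ⟩
    length X * (2 * (m + n))                          ≡⟨ cong (_* (2 * (m + n))) length-X ⟩
    2 * n * (2 * (m + n))                             ≡⟨ expand n m ⟩
    2 * (2 * n * m) + 2 * n * (2 * n)                 ∎))
    where
    open ≡-Reasoning
    D : List ℕ
    D = downFrom (2 * n)
    length-X : length X ≡ 2 * n
    length-X = length-beta f (2 * n)
    regroup : ∀ s d k → 2 * s + (d + d + k) ≡ s + d + (s + d) + k
    regroup = solve-∀
    expand : ∀ n m → 2 * n * (2 * (m + n)) ≡ 2 * (2 * n * m) + 2 * n * (2 * n)
    expand = solve-∀

lemma6p3 : (n m : ℕ) (α β μ : List ℕ)
    → IsPartition α → IsPartition β → IsPartition μ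
    → Complementary n m α β
    → EmptyCore2 μ
    → quot2 μ 0 ≈ₚ α → quot2 μ 1 ≈ₚ β
    → Balanced n m μ
lemma6p3 n m α β μ _ _ μ↘ αβ@(α-rows , _ , β-rows , _) core q₀ q₁
  with L , μ-2L , α-L , β-L , μ∼ ← two-quotient-beta μ α β μ↘ core q₀ q₁
  with μ-rows , μ∼′ ← remove-block L n (part-antitone μ↘) μ-2L α-L β-L α-rows β-rows μ∼ =
  balanced-criterion μ↘ μ-rows (ReflectionClosed-resp-∼ μ∼′ (complementary-closed n m α β αβ))
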